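{- If $\alpha$ is a join type-$B$ composition of $n$, then for any $\pi\in\mathfrak{H}_\alpha$ we have $\pi(i)>0$ for all $i\in[\alpha_1]$.
   Context: $\mathfrak{H}_n$: permutations $\pi$ of $\pm[n]=\{ -n,\dots,-1,1,\dots,n\}$ with $\pi(-a)=-\pi(a)$, product = composition; Coxeter group of type $B_n$ with simple generators $S=\{s_0,\dots,s_{n-1}\}$, $s_0$ exchanging $1,-1$ and $s_i$ exchanging $i,i+1$ and $-i,-i-1$; $\ell_S$ Coxeter length. A join type-$B$ composition of $n$ is a sequence $(\alpha_1,\dots,\alpha_r)$ of positive integers summing to $n$ (with no zero component); $p_i=\alpha_1+\dots+\alpha_i$. $\mathfrak{H}_\alpha=\{w\in\mathfrak{H}_n:\ell_S(ws)>\ell_S(w)\ \forall s\in S\setminus\{s_{p_1},\dots,s_{p_{r-1}}\}\}$. -}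

module Defs where

open import Data.Nat using (ℕ; zero; suc; _<_; _≤_; _<?_)
open import Data.Fin using (Fin; toℕ; fromℕ<)
open import Data.Integer using (ℤ; +_; -[1+_]; -_; ∣_∣)
import Data.Integer as ℤ
open import Data.List using (List; []; _∷_; map; length)
open import Data.List.Membership.Propositional using (_∉_)
open import Data.Product using (Σ; _×_; ∃-syntax)
open import Relation.Binary.PropositionalEquality using (_≡_; _≢_)
open import Relation.Nullary using (yes; no)

-- Elements of 𝔥_n are represented by their values on 1..n :
-- π : Fin n → ℤ, where index i : Fin n stands for the letter (toℕ i + 1).
-- The value on -a is determined by π(-a) = -π(a).

letter : {n : ℕ} → Fin n → ℤ
letter i = + suc (toℕ i)

IsSignedPerm : (n : ℕ) → (Fin n → ℤ) → Set
IsSignedPerm n π =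
  (∀ i → 1 ≤ ∣ π i ∣ × ∣ π i ∣ ≤ n) × (∀ i j → ∣ π i ∣ ≡ ∣ π j ∣ → i ≡ j)

ext : {n : ℕ} → (Fin n → ℤ) → ℤ → ℤ
ext {n} π (+ zero) = + zero
ext {n} π (+ suc k) with k <? n
... | yes k<n = π (fromℕ< k<n)
... | no  _   = + suc k
ext {n} π -[1+ k ] = - ext π (+ suc k)

swap : ℤ → ℤ → ℤ → ℤ
swap a b x with x ℤ.≟ a
... | yes _ = b
... | no  _ with x ℤ.≟ b
...   | yes _ = a
...   | no  _ = x

-- the simple generators s_0 , … , s_{n-1} of type B_n, as maps on ℤ
-- s_0 exchanges 1 and -1; s_j (j ≥ 1) exchanges j,j+1 and -j,-j-1
gen : {n : ℕ} → Fin n → ℤ → ℤ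
gen s with toℕ s
... | zero  = swap (+ 1) (- (+ 1))
... | suc j = λ x → swap (+ suc j) (+ suc (suc j)) (swap (- (+ suc j)) (- (+ suc (suc j))) x)

wordAct : {n : ℕ} → List (Fin n) → ℤ → ℤ
wordAct []      x = x
wordAct (s ∷ w) x = gen s (wordAct w x)

Represents : {n : ℕ} → List (Fin n) → (Fin n → ℤ) → Set
Represents w π = ∀ i → wordAct w (letter i) ≡ π i

HasLength : {n : ℕ} → (Fin n → ℤ) → ℕ → Set
HasLength {n} π k =
  (∃[ w ] (length w ≡ k × Represents w π)) × (∀ (w : List (Fin n)) → Represents w π → k ≤ length w)

mulGen : {n : ℕ} → (Fin n → ℤ) → Fin n → (Fin n → ℤ)
mulGen π s i = ext π (gen s (letter i))

Ascent : {n : ℕ} → (Fin n → ℤ) → Fin n → Set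
Ascent π s = ∀ k k′ → HasLength π k → HasLength (mulGen π s) k′ → k < k′

cuts : List ℕ → List ℕ
cuts []            = []
cuts (a ∷ [])      = []
cuts (a ∷ b ∷ as)  = a ∷ map (Data.Nat._+_ a) (cuts (b ∷ as))

InH : (n : ℕ) → List ℕ → (Fin n → ℤ) → Set
InH n α π = IsSignedPerm n π × (∀ (s : Fin n) → toℕ s ∉ cuts α → Ascent π s)

module Submission where

-- The Coxeter length of a signed permutation π equals the type-B inversion number of its
-- window [π(1), …, π(n)]. Right multiplication by a generator changes that number by exactly
-- one, so it bounds the length of every expression for π from below; conversely, undoing
-- descents one at a time (π(1) < 0 for s₀, π(j+1) < π(j) for s_j) sorts the window with
-- exactly that many generators. Hence an ascent s_j of π is not a descent of its window.
-- For π ∈ 𝔥_α every s_j with j < α₁ is an ascent, since all cuts p_i are at least α₁, and so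
-- 0 < π(1) < π(2) < ⋯ < π(α₁). Nothing else about α is used.

open import Defs
open import Data.Nat as ℕ using (ℕ; zero; suc; _+_; _≤_; _<_; z≤n; s≤s; z<s; s<s; _<?_)
import Data.Nat.Properties as ℕ
open import Data.Nat.ListAction using (sum)
open import Data.Nat.Tactic.RingSolver using (solve-∀)
open import Data.Integer as ℤ using (ℤ; +_; -[1+_]; -_; ∣_∣; +<+)
import Data.Integer.Properties as ℤ
open import Data.Fin using (Fin; toℕ; fromℕ<)
open import Data.Fin.Properties using (toℕ<n; toℕ-fromℕ<; fromℕ<-toℕ; fromℕ<-cong)
open import Data.List using (List; []; _∷_; _∷ʳ_; applyUpTo; length)
open import Data.List.Properties using (∷-injectiveˡ; ∷-injectiveʳ; length-++; length-applyUpTo)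
open import Data.List.Membership.Propositional using (_∉_)
open import Data.List.Relation.Unary.All as All using (All; []; _∷_)
import Data.List.Relation.Unary.All.Properties as All
open import Data.List.Relation.Unary.AllPairs using (AllPairs; []; _∷_)
import Data.List.Relation.Unary.AllPairs.Properties as AllPairs
open import Data.List.Relation.Unary.Linked using (Linked; []; [-]; _∷_)
open import Data.List.Relation.Unary.Linked.Properties as Linked using (Linked⇒AllPairs)
open import Data.Product using (Σ; _×_; _,_; proj₁; proj₂)
open import Data.Sum using (_⊎_; inj₁; inj₂)
open import Data.Empty using (⊥; ⊥-elim)
open import Function using (_∘_)
open import Relation.Binary.PropositionalEquality
  using (_≡_; _≢_; refl; sym; trans; cong; cong₂; subst; subst₂; module ≡-Reasoning)
open import Relation.Nullary using (Dec; yes; no; ¬_)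

[_<_] : ℤ → ℤ → ℕ
[ x < y ] with x ℤ.<? y
... | yes _ = 1
... | no  _ = 0

[<]≤1 : ∀ x y → [ x < y ] ≤ 1
[<]≤1 x y with x ℤ.<? y
... | yes _ = s≤s z≤n
... | no  _ = z≤n

[<]-yes : ∀ {x y} → x ℤ.< y → [ x < y ] ≡ 1
[<]-yes {x} {y} x<y with x ℤ.<? y
... | yes _   = refl
... | no  x≮y = ⊥-elim (x≮y x<y)

[<]-no : ∀ {x y} → ¬ x ℤ.< y → [ x < y ] ≡ 0
[<]-no {x} {y} x≮y with x ℤ.<? y
... | yes x<y = ⊥-elim (x≮y x<y)
... | no  _   = refl

neg-<-swap : ∀ {x y} → x ℤ.< - y → y ℤ.< - x
neg-<-swap {x} {y} x<-y = subst (ℤ._< - x) (ℤ.neg-involutive y) (ℤ.neg-mono-< x<-y)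

[<-]-swap : ∀ x y → [ y < - x ] ≡ [ x < - y ]
[<-]-swap x y with y ℤ.<? - x | x ℤ.<? - y
... | yes _   | yes _   = refl
... | no  _   | no  _   = refl
... | yes y<x | no  x≮y = ⊥-elim (x≮y (neg-<-swap y<x))
... | no  y≮x | yes x<y = ⊥-elim (y≮x (neg-<-swap x<y))

pairInversions : ℤ → List ℤ → ℕ
pairInversions x []       = 0
pairInversions x (y ∷ ys) = [ y < x ] + [ y < - x ] + pairInversions x ys

-- For the window L = [π(1), …, π(n)] this is the type-B inversion number
-- #{i : π(i) < 0} + #{i < j : π(j) < π(i)} + #{i < j : π(j) < -π(i)}.
inversions : List ℤ → ℕ
inversions []       = 0
inversions (x ∷ xs) = [ x < + 0 ] + pairInversions x xs + inversions xs

-- Right multiplication by s_j on windows: act 0 negates entry 0 and act (suc j) swaps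
-- entries j and j + 1 (entries counted from 0); Descent j L says that s_j is a descent.
act : ℕ → List ℤ → List ℤ
act zero          (x ∷ xs)     = - x ∷ xs
act (suc zero)    (x ∷ y ∷ xs) = y ∷ x ∷ xs
act (suc (suc j)) (x ∷ xs)     = x ∷ act (suc j) xs
act _             xs           = xs

Descent : ℕ → List ℤ → Set
Descent zero          (x ∷ _)     = x ℤ.< + 0
Descent (suc zero)    (x ∷ y ∷ _) = y ℤ.< x
Descent (suc (suc j)) (_ ∷ xs)    = Descent (suc j) xs
Descent _             _           = ⊥

pairInversions-neg : ∀ x ys → pairInversions (- x) ys ≡ pairInversions x ys
pairInversions-neg x [] = refl
pairInversions-neg x (y ∷ ys)
  rewrite ℤ.neg-involutive x | pairInversions-neg x ys
  = cong (_+ pairInversions x ys) (ℕ.+-comm [ y < - x ] [ y < x ])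

pairInversions-act-suc : ∀ x j ys → pairInversions x (act (suc j) ys) ≡ pairInversions x ys
pairInversions-act-suc x zero    []           = refl
pairInversions-act-suc x zero    (y ∷ [])     = refl
pairInversions-act-suc x zero    (y ∷ z ∷ zs) =
  swapSummands ([ z < x ] + [ z < - x ]) ([ y < x ] + [ y < - x ]) (pairInversions x zs)
  where
  swapSummands : ∀ a b c → a + (b + c) ≡ b + (a + c)
  swapSummands = solve-∀
pairInversions-act-suc x (suc j) []       = refl
pairInversions-act-suc x (suc j) (y ∷ ys) =
  cong (λ p → [ y < x ] + [ y < - x ] + p) (pairInversions-act-suc x j ys)

-- Multiplying by a generator changes the inversion number by exactly ±1; the next two
-- lemmas say this with an indicator on each side, so that no subtraction occurs.
inversions-neg-head : ∀ x xs →
  inversions (- x ∷ xs) + [ x < + 0 ] ≡ inversions (x ∷ xs) + [ - x < + 0 ]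
inversions-neg-head x xs rewrite pairInversions-neg x xs =
  rearrange [ - x < + 0 ] (pairInversions x xs) (inversions xs) [ x < + 0 ]
  where
  rearrange : ∀ a b c d → a + b + c + d ≡ d + b + c + a
  rearrange = solve-∀

inversions-transpose : ∀ x y zs →
  inversions (y ∷ x ∷ zs) + [ y < x ] ≡ inversions (x ∷ y ∷ zs) + [ x < y ]
inversions-transpose x y zs rewrite [<-]-swap y x =
  rearrange [ x < + 0 ] [ y < + 0 ] [ y < x ] [ x < y ] [ y < - x ]
            (pairInversions x zs) (pairInversions y zs) (inversions zs)
  where
  rearrange : ∀ a b p p′ q r s t →
    b + (p′ + q + s) + (a + r + t) + p ≡ a + (p + q + r) + (b + s + t) + p′
  rearrange = solve-∀

≤-suc-from-+≡ : ∀ {a b d e} → a + d ≡ b + e → e ≤ 1 → a ≤ suc b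
≤-suc-from-+≡ {a} {b} {d} {e} eq e≤1 = begin
  a         ≤⟨ ℕ.m≤m+n a d ⟩
  a + d     ≡⟨ eq ⟩
  b + e     ≤⟨ ℕ.+-monoʳ-≤ b e≤1 ⟩
  b + 1     ≡⟨ ℕ.+-comm b 1 ⟩
  suc b     ∎
  where open ℕ.≤-Reasoning

suc-from-+≡ : ∀ {a b} → a + 1 ≡ b + 0 → suc a ≡ b
suc-from-+≡ {a} {b} eq = trans (ℕ.+-comm 1 a) (trans eq (ℕ.+-identityʳ b))

neg≮0 : ∀ {x} → x ℤ.< + 0 → ¬ - x ℤ.< + 0
neg≮0 {x} x<0 -x<0 = ℤ.<-asym x<0 (subst (+ 0 ℤ.<_) (ℤ.neg-involutive x) (ℤ.neg-mono-< -x<0))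

inversions-∷-act-suc : ∀ x j xs → inversions (x ∷ act (suc j) xs)
                                   ≡ [ x < + 0 ] + pairInversions x xs + inversions (act (suc j) xs)
inversions-∷-act-suc x j xs =
  cong (λ p → [ x < + 0 ] + p + inversions (act (suc j) xs)) (pairInversions-act-suc x j xs)

inversions-act-≤ : ∀ j L → inversions (act j L) ≤ suc (inversions L)
inversions-act-≤ zero          []           = ℕ.n≤1+n 0
inversions-act-≤ zero          (x ∷ xs)     =
  ≤-suc-from-+≡ (inversions-neg-head x xs) ([<]≤1 (- x) (+ 0))
inversions-act-≤ (suc zero)    []           = ℕ.n≤1+n 0
inversions-act-≤ (suc zero)    (x ∷ [])     = ℕ.n≤1+n _
inversions-act-≤ (suc zero)    (x ∷ y ∷ zs) =
  ≤-suc-from-+≡ (inversions-transpose x y zs) ([<]≤1 x y)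
inversions-act-≤ (suc (suc j)) []           = ℕ.n≤1+n 0
inversions-act-≤ (suc (suc j)) (x ∷ xs) = begin
  inversions (x ∷ act (suc j) xs)                       ≡⟨ inversions-∷-act-suc x j xs ⟩
  [ x < + 0 ] + pairInversions x xs + inversions (act (suc j) xs)
    ≤⟨ ℕ.+-monoʳ-≤ ([ x < + 0 ] + pairInversions x xs) (inversions-act-≤ (suc j) xs) ⟩
  [ x < + 0 ] + pairInversions x xs + suc (inversions xs) ≡⟨ ℕ.+-suc _ (inversions xs) ⟩
  suc (inversions (x ∷ xs))                             ∎
  where open ℕ.≤-Reasoning

inversions-act-descent : ∀ j L → Descent j L → suc (inversions (act j L)) ≡ inversions L
inversions-act-descent zero (x ∷ xs) x<0 =
  suc-from-+≡ (subst₂ (λ d e → inversions (- x ∷ xs) + d ≡ inversions (x ∷ xs) + e)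
                      ([<]-yes x<0) ([<]-no (neg≮0 x<0)) (inversions-neg-head x xs))
inversions-act-descent (suc zero) (x ∷ y ∷ zs) y<x =
  suc-from-+≡ (subst₂ (λ d e → inversions (y ∷ x ∷ zs) + d ≡ inversions (x ∷ y ∷ zs) + e)
                      ([<]-yes y<x) ([<]-no (ℤ.<-asym y<x)) (inversions-transpose x y zs))
inversions-act-descent (suc (suc j)) (x ∷ xs) d = begin
  suc (inversions (x ∷ act (suc j) xs))
    ≡⟨ cong suc (inversions-∷-act-suc x j xs) ⟩
  suc ([ x < + 0 ] + pairInversions x xs + inversions (act (suc j) xs))
    ≡⟨ ℕ.+-suc _ (inversions (act (suc j) xs)) ⟨
  [ x < + 0 ] + pairInversions x xs + suc (inversions (act (suc j) xs))
    ≡⟨ cong (λ m → [ x < + 0 ] + pairInversions x xs + m) (inversions-act-descent (suc j) xs d) ⟩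
  inversions (x ∷ xs) ∎
  where open ≡-Reasoning

IsOdd : (ℤ → ℤ) → Set
IsOdd F = ∀ x → F (- x) ≡ - F x

swap-first : ∀ a b → swap a b a ≡ b
swap-first a b with a ℤ.≟ a
... | yes _   = refl
... | no  a≢a = ⊥-elim (a≢a refl)

swap-second : ∀ a b → a ≢ b → swap a b b ≡ a
swap-second a b a≢b with b ℤ.≟ a
... | yes b≡a = ⊥-elim (a≢b (sym b≡a))
... | no  _ with b ℤ.≟ b
...   | yes _   = refl
...   | no  b≢b = ⊥-elim (b≢b refl)

swap-other : ∀ a b x → x ≢ a → x ≢ b → swap a b x ≡ x
swap-other a b x x≢a x≢b with x ℤ.≟ a
... | yes x≡a = ⊥-elim (x≢a x≡a)
... | no  _ with x ℤ.≟ b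
...   | yes x≡b = ⊥-elim (x≢b x≡b)
...   | no  _   = refl

neg-≡-swap : ∀ {x y} → - x ≡ y → x ≡ - y
neg-≡-swap {x} refl = sym (ℤ.neg-involutive x)

swap-neg : ∀ a b x → swap a b (- x) ≡ - swap (- a) (- b) x
swap-neg a b x with - x ℤ.≟ a | x ℤ.≟ - a
... | yes _ | yes _ = sym (ℤ.neg-involutive b)
... | yes p | no  q = ⊥-elim (q (neg-≡-swap p))
... | no  p | yes q = ⊥-elim (p (sym (neg-≡-swap (sym q))))
... | no  _ | no  _ with - x ℤ.≟ b | x ℤ.≟ - b
...   | yes _ | yes _ = sym (ℤ.neg-involutive a)
...   | yes p | no  q = ⊥-elim (q (neg-≡-swap p))
...   | no  p | yes q = ⊥-elim (p (sym (neg-≡-swap (sym q))))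
...   | no  _ | no  _ = refl

swap-sym : ∀ a b x → a ≢ b → swap a b x ≡ swap b a x
swap-sym a b x a≢b = bySplit (x ℤ.≟ a) (x ℤ.≟ b)
  where
  bySplit : Dec (x ≡ a) → Dec (x ≡ b) → swap a b x ≡ swap b a x
  bySplit (yes refl) _ = trans (swap-first x b) (sym (swap-second b x (a≢b ∘ sym)))
  bySplit (no x≢a) (yes refl) = trans (swap-second a x a≢b) (sym (swap-first x a))
  bySplit (no x≢a) (no x≢b) = trans (swap-other a b x x≢a x≢b) (sym (swap-other b a x x≢b x≢a))

swap-comm : ∀ a b c d x → a ≢ b → c ≢ d → a ≢ c → a ≢ d → b ≢ c → b ≢ d →
  swap a b (swap c d x) ≡ swap c d (swap a b x)
swap-comm a b c d x a≢b c≢d a≢c a≢d b≢c b≢d =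
  bySplit (x ℤ.≟ a) (x ℤ.≟ b) (x ℤ.≟ c) (x ℤ.≟ d)
  where
  bySplit : Dec (x ≡ a) → Dec (x ≡ b) → Dec (x ≡ c) → Dec (x ≡ d) →
    swap a b (swap c d x) ≡ swap c d (swap a b x)
  bySplit (yes refl) _ _ _
    rewrite swap-other c d x a≢c a≢d | swap-first x b | swap-other c d b b≢c b≢d = refl
  bySplit (no x≢a) (yes refl) _ _
    rewrite swap-other c d x b≢c b≢d | swap-second a x a≢b | swap-other c d a a≢c a≢d = refl
  bySplit (no x≢a) (no x≢b) (yes refl) _
    rewrite swap-first x d | swap-other a b d (a≢d ∘ sym) (b≢d ∘ sym)
          | swap-other a b x x≢a x≢b | swap-first x d = refl
  bySplit (no x≢a) (no x≢b) (no x≢c) (yes refl)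
    rewrite swap-second c x c≢d | swap-other a b c (a≢c ∘ sym) (b≢c ∘ sym)
          | swap-other a b x x≢a x≢b | swap-second c x c≢d = refl
  bySplit (no x≢a) (no x≢b) (no x≢c) (no x≢d)
    rewrite swap-other c d x x≢c x≢d | swap-other a b x x≢a x≢b | swap-other c d x x≢c x≢d = refl

gen-odd : ∀ {n} (s : Fin n) → IsOdd (gen s)
gen-odd s x with toℕ s
... | zero  = trans (swap-neg (+ 1) (- (+ 1)) x) (cong -_ (swap-sym -[1+ 0 ] (+ 1) x (λ ())))
... | suc j = begin
  swap P Q (swap (- P) (- Q) (- x))      ≡⟨ cong (swap P Q) (swap-neg (- P) (- Q) x) ⟩
  swap P Q (- swap P Q x)                ≡⟨ swap-neg P Q (swap P Q x) ⟩
  - swap (- P) (- Q) (swap P Q x)        ≡⟨ cong -_ (swap-comm (- P) (- Q) P Q x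
                                              (λ ()) (λ ()) (λ ()) (λ ()) (λ ()) (λ ())) ⟩
  - swap P Q (swap (- P) (- Q) x)        ∎
  where
  open ≡-Reasoning
  P Q : ℤ
  P = + suc j
  Q = + suc (suc j)

wordAct-odd : ∀ {n} (w : List (Fin n)) → IsOdd (wordAct w)
wordAct-odd []      x = refl
wordAct-odd (s ∷ w) x = trans (cong (gen s) (wordAct-odd w x)) (gen-odd s (wordAct w x))

wordAct-∷ʳ : ∀ {n} (w : List (Fin n)) s x → wordAct (w ∷ʳ s) x ≡ wordAct w (gen s x)
wordAct-∷ʳ []      s x = refl
wordAct-∷ʳ (t ∷ w) s x = cong (gen t) (wordAct-∷ʳ w s x)

applyUpTo-cong : ∀ {A : Set} {f g : ℕ → A} m → (∀ {t} → t < m → f t ≡ g t) →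
  applyUpTo f m ≡ applyUpTo g m
applyUpTo-cong zero    f≡g = refl
applyUpTo-cong (suc m) f≡g = cong₂ _∷_ (f≡g z<s) (applyUpTo-cong m (f≡g ∘ s<s))

applyUpTo-injective : ∀ {A : Set} {f g : ℕ → A} m → applyUpTo f m ≡ applyUpTo g m →
  ∀ {t} → t < m → f t ≡ g t
applyUpTo-injective (suc m) eq {zero}  _         = ∷-injectiveˡ eq
applyUpTo-injective (suc m) eq {suc t} (s<s t<m) = applyUpTo-injective m (∷-injectiveʳ eq) t<m

applyUpTo-act-zero : ∀ (f g : ℕ → ℤ) m → g 0 ≡ - f 0 → (∀ t → g (suc t) ≡ f (suc t)) →
  applyUpTo g (suc m) ≡ act 0 (applyUpTo f (suc m))
applyUpTo-act-zero f g m g₀ gₛ = cong₂ _∷_ g₀ (applyUpTo-cong m (λ {t} _ → gₛ t))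

applyUpTo-act-suc : ∀ (f g : ℕ → ℤ) j m → suc (suc j) ≤ m →
  g j ≡ f (suc j) → g (suc j) ≡ f j → (∀ t → t ≢ j → t ≢ suc j → g t ≡ f t) →
  applyUpTo g m ≡ act (suc j) (applyUpTo f m)
applyUpTo-act-suc f g zero (suc (suc m)) (s≤s (s≤s _)) gⱼ gⱼ₊₁ gₜ =
  cong₂ _∷_ gⱼ (cong₂ _∷_ gⱼ₊₁ (applyUpTo-cong m (λ _ → gₜ _ (λ ()) (λ ()))))
applyUpTo-act-suc f g (suc j) (suc m) (s≤s j+2≤m) gⱼ gⱼ₊₁ gₜ =
  cong₂ _∷_ (gₜ 0 (λ ()) (λ ()))
    (applyUpTo-act-suc (f ∘ suc) (g ∘ suc) j m j+2≤m gⱼ gⱼ₊₁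
      (λ t t≢j t≢j+1 → gₜ (suc t) (t≢j ∘ ℕ.suc-injective) (t≢j+1 ∘ ℕ.suc-injective)))

applyUpTo-descent-suc : ∀ (f : ℕ → ℤ) j m → suc (suc j) ≤ m → f (suc j) ℤ.< f j →
  Descent (suc j) (applyUpTo f m)
applyUpTo-descent-suc f zero    (suc (suc m)) (s≤s (s≤s _)) fⱼ₊₁<fⱼ = fⱼ₊₁<fⱼ
applyUpTo-descent-suc f (suc j) (suc m)       (s≤s j+2≤m)   fⱼ₊₁<fⱼ =
  applyUpTo-descent-suc (f ∘ suc) j m j+2≤m fⱼ₊₁<fⱼ

window : (ℤ → ℤ) → ℕ → List ℤ
window F = applyUpTo (λ t → F (+ suc t))

window-gen : ∀ {n} (s : Fin n) (F : ℤ → ℤ) → F -[1+ 0 ] ≡ - F (+ 1) →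
  window (F ∘ gen s) n ≡ act (toℕ s) (window F n)
window-gen {n} s F F-odd₁ with toℕ s | toℕ<n s
... | zero  | s≤s {n = m} z≤n =
  applyUpTo-act-zero (λ t → F (+ suc t)) (λ t → F (swap (+ 1) -[1+ 0 ] (+ suc t))) m
    (trans (cong F (swap-first (+ 1) -[1+ 0 ])) F-odd₁)
    (λ t → cong F (swap-other (+ 1) -[1+ 0 ] (+ suc (suc t)) (λ ()) (λ ())))
... | suc j | j+2≤n =
  applyUpTo-act-suc (λ t → F (+ suc t)) _ j n j+2≤n
    (cong F (trans (fixes-negatives (suc j)) (swap-first P Q)))
    (cong F (trans (fixes-negatives (suc (suc j))) (swap-second P Q (λ ()))))
    (λ t t≢j t≢j+1 → cong F (trans (fixes-negatives (suc t))
      (swap-other P Q (+ suc t) (t≢j ∘ suc-+-injective) (t≢j+1 ∘ suc-+-injective))))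
  where
  P Q : ℤ
  P = + suc j
  Q = + suc (suc j)
  fixes-negatives : ∀ k → swap P Q (swap (- P) (- Q) (+ k)) ≡ swap P Q (+ k)
  fixes-negatives k = cong (swap P Q) (swap-other (- P) (- Q) (+ k) (λ ()) (λ ()))
  suc-+-injective : ∀ {k l} → + suc k ≡ + suc l → k ≡ l
  suc-+-injective = ℕ.suc-injective ∘ ℤ.+-injective

inversions-window-wordAct : ∀ {n} (w : List (Fin n)) F → IsOdd F →
  inversions (window (F ∘ wordAct w) n) ≤ inversions (window F n) + length w
inversions-window-wordAct {n} []      F F-odd = ℕ.m≤m+n _ 0
inversions-window-wordAct {n} (s ∷ w) F F-odd = begin
  inversions (window (F ∘ gen s ∘ wordAct w) n)
    ≤⟨ inversions-window-wordAct w (F ∘ gen s) Fs-odd ⟩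
  inversions (window (F ∘ gen s) n) + length w
    ≡⟨ cong (λ L → inversions L + length w) (window-gen s F (F-odd (+ 1))) ⟩
  inversions (act (toℕ s) (window F n)) + length w
    ≤⟨ ℕ.+-monoˡ-≤ (length w) (inversions-act-≤ (toℕ s) (window F n)) ⟩
  suc (inversions (window F n)) + length w        ≡⟨ ℕ.+-suc _ (length w) ⟨
  inversions (window F n) + length (s ∷ w)        ∎
  where
  open ℕ.≤-Reasoning
  Fs-odd : IsOdd (F ∘ gen s)
  Fs-odd x = trans (cong F (gen-odd s x)) (F-odd (gen s x))

pairInversions-below : ∀ {x} ys → + 0 ℤ.< x → All (x ℤ.<_) ys → pairInversions x ys ≡ 0
pairInversions-below []       0<x []           = refl
pairInversions-below (y ∷ ys) 0<x (x<y ∷ x<ys)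
  rewrite [<]-no (ℤ.<-asym x<y)
        | [<]-no (ℤ.<-asym (ℤ.<-trans (ℤ.neg-mono-< 0<x) (ℤ.<-trans 0<x x<y)))
  = pairInversions-below ys 0<x x<ys

inversions-sorted : ∀ L → All (+ 0 ℤ.<_) L → AllPairs ℤ._<_ L → inversions L ≡ 0
inversions-sorted []       []           []            = refl
inversions-sorted (x ∷ xs) (0<x ∷ 0<xs) (x<xs ∷ <xs)
  rewrite [<]-no (ℤ.<-asym 0<x) | pairInversions-below xs 0<x x<xs
  = inversions-sorted xs 0<xs <xs

inversions-increasing : ∀ L → Linked ℤ._<_ (+ 0 ∷ L) → inversions L ≡ 0
inversions-increasing L increasing with Linked⇒AllPairs ℤ.<-trans increasing
... | 0<L ∷ <L = inversions-sorted L 0<L <L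

inversions-window-id : ∀ n → inversions (window (λ x → x) n) ≡ 0
inversions-window-id n =
  inversions-increasing _ (Linked.applyUpTo⁺₂ +_ (suc n) (λ t → +<+ (ℕ.n<1+n t)))

inversions-window-wordAct-≤-length : ∀ {n} (w : List (Fin n)) →
  inversions (window (wordAct w) n) ≤ length w
inversions-window-wordAct-≤-length {n} w =
  subst (λ k → inversions (window (wordAct w) n) ≤ k + length w) (inversions-window-id n)
    (inversions-window-wordAct w (λ x → x) (λ x → refl))

length-act : ∀ j L → length (act j L) ≡ length L
length-act zero          []           = refl
length-act zero          (x ∷ xs)     = refl
length-act (suc zero)    []           = refl
length-act (suc zero)    (x ∷ [])     = refl
length-act (suc zero)    (x ∷ y ∷ xs) = refl
length-act (suc (suc j)) []           = refl
length-act (suc (suc j)) (x ∷ xs)     = cong suc (length-act (suc j) xs)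

act-involutive : ∀ j L → act j (act j L) ≡ L
act-involutive zero          []           = refl
act-involutive zero          (x ∷ xs)     = cong (_∷ xs) (ℤ.neg-involutive x)
act-involutive (suc zero)    []           = refl
act-involutive (suc zero)    (x ∷ [])     = refl
act-involutive (suc zero)    (x ∷ y ∷ xs) = refl
act-involutive (suc (suc j)) []           = refl
act-involutive (suc (suc j)) (x ∷ xs)     = cong (x ∷_) (act-involutive (suc j) xs)

module _ {P : ℤ → Set} (P-neg : ∀ {x} → P x → P (- x)) where

  All-act : ∀ j {L} → All P L → All P (act j L)
  All-act zero          {[]}         []                = []
  All-act zero          {x ∷ xs}     (px ∷ pxs)        = P-neg px ∷ pxs
  All-act (suc zero)    {[]}         []                = []
  All-act (suc zero)    {x ∷ []}     (px ∷ [])         = px ∷ []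
  All-act (suc zero)    {x ∷ y ∷ xs} (px ∷ py ∷ pxs)   = py ∷ px ∷ pxs
  All-act (suc (suc j)) {[]}         []                = []
  All-act (suc (suc j)) {x ∷ xs}     (px ∷ pxs)        = px ∷ All-act (suc j) pxs

DistinctAbs : ℤ → ℤ → Set
DistinctAbs x y = ∣ x ∣ ≢ ∣ y ∣

AllPairs-act : ∀ j {L} → AllPairs DistinctAbs L → AllPairs DistinctAbs (act j L)
AllPairs-act zero          {[]}         []                     = []
AllPairs-act zero          {x ∷ xs}     (x#xs ∷ #xs)           =
  All.map (λ x#y → x#y ∘ trans (sym (ℤ.∣-i∣≡∣i∣ x))) x#xs ∷ #xs
AllPairs-act (suc zero)    {[]}         []                     = []
AllPairs-act (suc zero)    {x ∷ []}     #x                     = #x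
AllPairs-act (suc zero)    {x ∷ y ∷ xs} ((x#y ∷ x#xs) ∷ y#xs ∷ #xs) =
  ((x#y ∘ sym) ∷ y#xs) ∷ x#xs ∷ #xs
AllPairs-act (suc (suc j)) {[]}         []                     = []
AllPairs-act (suc (suc j)) {x ∷ xs}     (x#xs ∷ #xs)           =
  All-act (λ {y} x#y e → x#y (trans e (ℤ.∣-i∣≡∣i∣ y))) (suc j) x#xs ∷ AllPairs-act (suc j) #xs

Bounded : ℕ → ℤ → Set
Bounded n x = 1 ≤ ∣ x ∣ × ∣ x ∣ ≤ n

record SignedWindow (n : ℕ) (L : List ℤ) : Set where
  field
    length≡ : length L ≡ n
    bounded  : All (Bounded n) L
    distinct : AllPairs DistinctAbs L

act-SignedWindow : ∀ {n} j {L} → SignedWindow n L → SignedWindow n (act j L)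
act-SignedWindow {n} j {L} w = record
  { length≡  = trans (length-act j L) length≡
  ; bounded  = All-act (λ {x} → subst (λ a → 1 ≤ a × a ≤ n) (sym (ℤ.∣-i∣≡∣i∣ x))) j bounded
  ; distinct = AllPairs-act j distinct
  }
  where open SignedWindow w

descentOrIncreasing-∷ : ∀ x xs → AllPairs DistinctAbs (x ∷ xs) →
  (Σ ℕ λ j → suc j < length (x ∷ xs) × Descent (suc j) (x ∷ xs)) ⊎ Linked ℤ._<_ (x ∷ xs)
descentOrIncreasing-∷ x []       _                  = inj₂ [-]
descentOrIncreasing-∷ x (y ∷ ys) ((x#y ∷ _) ∷ #yys) with y ℤ.<? x
... | yes y<x = inj₁ (0 , s<s z<s , y<x)
... | no  y≮x with descentOrIncreasing-∷ y ys #yys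
...   | inj₁ (j , j<len , descent) = inj₁ (suc j , s<s j<len , descent)
...   | inj₂ increasing            = inj₂ (ℤ.≤∧≢⇒< (ℤ.≮⇒≥ y≮x) (x#y ∘ cong ∣_∣) ∷ increasing)

descentOrIncreasing : ∀ {n} L → SignedWindow n L →
  (Σ ℕ λ j → j < n × Descent j L) ⊎ Linked ℤ._<_ (+ 0 ∷ L)
descentOrIncreasing []       _ = inj₂ [-]
descentOrIncreasing (x ∷ xs) record { length≡ = refl ; bounded = (1≤∣x∣ , _) ∷ _ ; distinct = #xxs }
  with x ℤ.<? + 0
... | yes x<0 = inj₁ (0 , z<s , x<0)
... | no  x≮0 with descentOrIncreasing-∷ x xs #xxs
...   | inj₁ (j , j<n , descent) = inj₁ (suc j , j<n , descent)
...   | inj₂ increasing            =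
  inj₂ (ℤ.≤∧≢⇒< (ℤ.≮⇒≥ x≮0) (λ 0≡x → ℕ.<-irrefl (cong ∣_∣ 0≡x) 1≤∣x∣) ∷ increasing)

increasing-length : ∀ {k B} L → k ≤ B → Linked ℤ._<_ (+ k ∷ L) → All (λ x → ∣ x ∣ ≤ B) L →
  k + length L ≤ B
increasing-length {k} []       k≤B _ _ = subst (_≤ _) (sym (ℕ.+-identityʳ k)) k≤B
increasing-length {k} {B} (+ x ∷ xs) _ (+<+ k<x ∷ increasing) (x≤B ∷ xs≤B) = begin
  k + suc (length xs) ≡⟨ ℕ.+-suc k (length xs) ⟩
  suc k + length xs   ≤⟨ ℕ.+-monoˡ-≤ (length xs) k<x ⟩
  x + length xs       ≤⟨ increasing-length xs x≤B increasing xs≤B ⟩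
  B                   ∎
  where open ℕ.≤-Reasoning
increasing-length (-[1+ _ ] ∷ xs) _ (() ∷ _) _

increasing⇒applyUpTo : ∀ k L → Linked ℤ._<_ (+ k ∷ L) → All (λ x → ∣ x ∣ ≤ k + length L) L →
  L ≡ applyUpTo (λ t → + suc (k + t)) (length L)
increasing⇒applyUpTo k []         _                      _ = refl
increasing⇒applyUpTo k (+ x ∷ xs) (+<+ k<x ∷ increasing) (x≤ ∷ xs≤)
  with ℕ.≤-antisym x≤suc-k k<x
  where
  x≤suc-k : x ≤ suc k
  x≤suc-k = ℕ.+-cancelʳ-≤ (length xs) x (suc k)
    (subst (x + length xs ≤_) (ℕ.+-suc k (length xs)) (increasing-length xs x≤ increasing xs≤))
... | refl = cong₂ _∷_ (cong (λ m → + suc m) (sym (ℕ.+-identityʳ k))) (begin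
  xs                                              ≡⟨ increasing⇒applyUpTo (suc k) xs increasing xs≤′ ⟩
  applyUpTo (λ t → + suc (suc k + t)) (length xs)
    ≡⟨ applyUpTo-cong (length xs) (λ {t} _ → cong (λ m → + suc m) (sym (ℕ.+-suc k t))) ⟩
  applyUpTo (λ t → + suc (k + suc t)) (length xs) ∎)
  where
  open ≡-Reasoning
  xs≤′ : All (λ y → ∣ y ∣ ≤ suc k + length xs) xs
  xs≤′ = subst (λ b → All (λ y → ∣ y ∣ ≤ b) xs) (ℕ.+-suc k (length xs)) xs≤
increasing⇒applyUpTo k (-[1+ _ ] ∷ xs) (() ∷ _) _

increasing⇒window-id : ∀ {n} L → SignedWindow n L → Linked ℤ._<_ (+ 0 ∷ L) →
  window (λ x → x) n ≡ L
increasing⇒window-id L record { length≡ = refl ; bounded = bounded } increasing =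
  sym (increasing⇒applyUpTo 0 L increasing (All.map proj₂ bounded))

window-wordAct-∷ʳ : ∀ {n} (w : List (Fin n)) s →
  window (wordAct (w ∷ʳ s)) n ≡ act (toℕ s) (window (wordAct w) n)
window-wordAct-∷ʳ {n} w s = begin
  window (wordAct (w ∷ʳ s)) n        ≡⟨ applyUpTo-cong n (λ _ → wordAct-∷ʳ w s _) ⟩
  window (wordAct w ∘ gen s) n        ≡⟨ window-gen s (wordAct w) (wordAct-odd w (+ 1)) ⟩
  act (toℕ s) (window (wordAct w) n) ∎
  where open ≡-Reasoning

sortingWord : ∀ {n} m L → inversions L ≡ m → SignedWindow n L →
  Σ (List (Fin n)) λ w → window (wordAct w) n ≡ L × length w ≡ m
sortingWord m L inv≡m sw with descentOrIncreasing L sw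
... | inj₂ increasing =
  [] , increasing⇒window-id L sw increasing , trans (sym (inversions-increasing L increasing)) inv≡m
... | inj₁ (j , j<n , descent) with m | trans (inversions-act-descent j L descent) inv≡m
...   | zero  | ()
...   | suc m | inv-act≡m
  with sortingWord m (act j L) (ℕ.suc-injective inv-act≡m) (act-SignedWindow j sw)
...   | w , window≡ , length≡ = w ∷ʳ s , window≡L , length≡suc-m
  where
  s = fromℕ< j<n
  window≡L : window (wordAct (w ∷ʳ s)) _ ≡ L
  window≡L = begin
    window (wordAct (w ∷ʳ s)) _         ≡⟨ window-wordAct-∷ʳ w s ⟩
    act (toℕ s) (window (wordAct w) _)  ≡⟨ cong₂ act (toℕ-fromℕ< j<n) window≡ ⟩
    act j (act j L)                     ≡⟨ act-involutive j L ⟩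
    L                                   ∎
    where open ≡-Reasoning
  length≡suc-m : length (w ∷ʳ s) ≡ suc m
  length≡suc-m = trans (length-++ w) (trans (ℕ.+-comm (length w) 1) (cong suc length≡))

ext-pos : ∀ {n} (π : Fin n → ℤ) {t} (t<n : t < n) → ext π (+ suc t) ≡ π (fromℕ< t<n)
ext-pos {n} π {t} t<n with t <? n
... | yes t<n′ = cong π (fromℕ<-cong t t refl t<n′ t<n)
... | no  t≮n  = ⊥-elim (t≮n t<n)

ext-letter : ∀ {n} (π : Fin n → ℤ) i → ext π (letter i) ≡ π i
ext-letter π i = trans (ext-pos π (toℕ<n i)) (cong π (fromℕ<-toℕ i (toℕ<n i)))

window-represents : ∀ {n} (w : List (Fin n)) π → Represents w π →
  window (wordAct w) n ≡ window (ext π) n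
window-represents {n} w π represents = applyUpTo-cong n λ {t} t<n → begin
  wordAct w (+ suc t)               ≡⟨ cong (λ k → wordAct w (+ suc k)) (toℕ-fromℕ< t<n) ⟨
  wordAct w (letter (fromℕ< t<n))   ≡⟨ represents (fromℕ< t<n) ⟩
  π (fromℕ< t<n)                    ≡⟨ ext-pos π t<n ⟨
  ext π (+ suc t)                   ∎
  where open ≡-Reasoning

represents-window : ∀ {n} (w : List (Fin n)) π → window (wordAct w) n ≡ window (ext π) n →
  Represents w π
represents-window {n} w π window≡ i =
  trans (applyUpTo-injective n window≡ (toℕ<n i)) (ext-letter π i)

ext-bounded : ∀ {n} {π : Fin n → ℤ} → IsSignedPerm n π →
  ∀ {t} → t < n → Bounded n (ext π (+ suc t))
ext-bounded {n} {π} (bounded , _) t<n =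
  subst (Bounded n) (sym (ext-pos π t<n)) (bounded (fromℕ< t<n))

ext-nonzero : ∀ {n} {π : Fin n → ℤ} → IsSignedPerm n π → ∀ {t} → t < n → ext π (+ suc t) ≢ + 0
ext-nonzero signedPerm t<n πt≡0 =
  ℕ.<-irrefl (sym (cong ∣_∣ πt≡0)) (proj₁ (ext-bounded signedPerm t<n))

signedPerm-window : ∀ {n} {π : Fin n → ℤ} → IsSignedPerm n π → SignedWindow n (window (ext π) n)
signedPerm-window {n} {π} signedPerm@(_ , injective) = record
  { length≡  = length-applyUpTo _ n
  ; bounded  = All.applyUpTo⁺₁ _ n (ext-bounded signedPerm)
  ; distinct = AllPairs.applyUpTo⁺₁ _ n λ i<j j<n → distinctAt (ℕ.<-trans i<j j<n) j<n (ℕ.<⇒≢ i<j)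
  }
  where
  distinctAt : ∀ {i j} (i<n : i < n) (j<n : j < n) → i ≢ j →
    ∣ ext π (+ suc i) ∣ ≢ ∣ ext π (+ suc j) ∣
  distinctAt i<n j<n i≢j ∣πi∣≡∣πj∣ = i≢j (begin
    _                        ≡⟨ toℕ-fromℕ< i<n ⟨
    toℕ (fromℕ< i<n)         ≡⟨ cong toℕ (injective _ _ (subst₂ (λ x y → ∣ x ∣ ≡ ∣ y ∣)
                                   (ext-pos π i<n) (ext-pos π j<n) ∣πi∣≡∣πj∣)) ⟩
    toℕ (fromℕ< j<n)         ≡⟨ toℕ-fromℕ< j<n ⟩
    _                        ∎)
    where open ≡-Reasoning

window-mulGen : ∀ {n} (π : Fin n → ℤ) s →
  window (ext (mulGen π s)) n ≡ act (toℕ s) (window (ext π) n)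
window-mulGen {n} π s = trans
  (applyUpTo-cong n λ t<n → trans (ext-pos (mulGen π s) t<n)
                                  (cong (λ k → ext π (gen s (+ suc k))) (toℕ-fromℕ< t<n)))
  (window-gen s (ext π) refl)

hasLength-inversions : ∀ {n} (π : Fin n → ℤ) → SignedWindow n (window (ext π) n) →
  HasLength π (inversions (window (ext π) n))
hasLength-inversions π sw with sortingWord _ _ refl sw
... | w , window≡ , length≡ =
  (w , length≡ , represents-window w π window≡) ,
  λ w′ represents → subst (_≤ length w′) (cong inversions (window-represents w′ π represents))
                          (inversions-window-wordAct-≤-length w′)

ascent⇒¬descent : ∀ {n} (π : Fin n → ℤ) {j} (j<n : j < n) → IsSignedPerm n π →
  Ascent π (fromℕ< j<n) → ¬ Descent j (window (ext π) n)
ascent⇒¬descent {n} π {j} j<n signedPerm ascent descent =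
  ℕ.<-asym (ascent _ _ (hasLength-inversions π sw) (hasLength-inversions (mulGen π s) sw′))
           (subst (λ L → inversions L < inversions (window (ext π) n)) (sym window≡)
                  (ℕ.≤-reflexive (inversions-act-descent j _ descent)))
  where
  s = fromℕ< j<n
  window≡ : window (ext (mulGen π s)) n ≡ act j (window (ext π) n)
  window≡ = trans (window-mulGen π s) (cong (λ k → act k (window (ext π) n)) (toℕ-fromℕ< j<n))
  sw = signedPerm-window signedPerm
  sw′ = subst (SignedWindow n) (sym window≡) (act-SignedWindow j sw)

noDescent⇒positive : ∀ (f : ℕ → ℤ) {a m} → (∀ {t} → t < m → f t ≢ + 0) →
  (∀ {j} → j < a → j < m → ¬ Descent j (applyUpTo f m)) →
  ∀ {t} → t < a → t < m → + 0 ℤ.< f t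
noDescent⇒positive f nonzero noDescent {zero} 0<a (z<s {m}) with f 0 ℤ.<? + 0
... | yes f₀<0 = ⊥-elim (noDescent 0<a z<s f₀<0)
... | no  f₀≮0 = ℤ.≤∧≢⇒< (ℤ.≮⇒≥ f₀≮0) (nonzero z<s ∘ sym)
noDescent⇒positive f nonzero noDescent {suc t} t+1<a t+1<m with f (suc t) ℤ.<? f t
... | yes descent = ⊥-elim (noDescent t+1<a t+1<m (applyUpTo-descent-suc f t _ t+1<m descent))
... | no  ascent  = ℤ.<-≤-trans
  (noDescent⇒positive f nonzero noDescent (ℕ.<⇒≤ t+1<a) (ℕ.<⇒≤ t+1<m))
  (ℤ.≮⇒≥ ascent)

cuts-≥ : ∀ a as → All (a ≤_) (cuts (a ∷ as))
cuts-≥ a []       = []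
cuts-≥ a (b ∷ as) = ℕ.≤-refl ∷ All.map⁺ (All.universal (ℕ.m≤m+n a) _)

∉-cuts : ∀ {a as t} → t < a → t ∉ cuts (a ∷ as)
∉-cuts {a} {as} t<a t∈cuts = ℕ.<⇒≱ t<a (All.lookup (cuts-≥ a as) t∈cuts)

lemma45 : (n : ℕ) (a : ℕ) (as : List ℕ) → All (λ x → 0 < x) (a ∷ as) → sum (a ∷ as) ≡ n →
          (π : Fin n → ℤ) → InH n (a ∷ as) π →
          (i : Fin n) → toℕ i < a → + 0 ℤ.< π i
lemma45 n a as _ _ π (signedPerm , ascents) i i<a =
  subst (+ 0 ℤ.<_) (ext-letter π i)
    (noDescent⇒positive (λ t → ext π (+ suc t)) (ext-nonzero signedPerm) noDescent i<a (toℕ<n i))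
  where
  noDescent : ∀ {j} → j < a → j < n → ¬ Descent j (window (ext π) n)
  noDescent j<a j<n = ascent⇒¬descent π j<n signedPerm
    (ascents _ (∉-cuts (subst (_< a) (sym (toℕ-fromℕ< j<n)) j<a)))
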